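{- Let $m,n$ be positive integers, $N=mn$, $g_{m,n}=m\binom{n}{2}-n+1$, and \[ \mathcal{D}_{m,n}=\Big\{(x_1,\dots,x_n)\in\mathbb{Z}^n : 0\le x_i\le N-1,\ \sum_{i=1}^n x_i\equiv g_{m,n}\pmod N\Big\}. \] Define $\mathrm{shift}(x_1,\dots,x_n)=(x_1+m,\dots,x_n+m)$ with entries reduced modulo $N$ into $\{0,\dots,N-1\}$, and call two elements of $\mathcal{D}_{m,n}$ shift-equivalent if one is obtained from the other by applying $\mathrm{shift}^j$ for some $j\in\mathbb{N}$. Then every shift-equivalence class $\mathcal{C}\subseteq\mathcal{D}_{m,n}$ contains a unique element $\mathbf a\in\mathcal{C}$ with $\mathbf a\in\mathrm{Break}_{m,n}$.
   Context: $\mathrm{Break}_{m,n}$ is the set of break divisors on the complete multigraph $K_n^m$ (vertex set $[n]$, exactly $m$ edges between each pair of distinct vertices). For a graph $H$, $g(H)=|E(H)|-|V(H)|+1$. A divisor is a vector $D\in\mathbb{Z}^n$ indexed by the vertices; a break divisor on $K_n^m$ is a divisor $D$ with all entries $\ge0$, entry sum $g(K_n^m)=g_{m,n}$, and $\sum_{v\in V(H)}D(v)\ge g(H)$ for every induced subgraph $H$ of $K_n^m$. -}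

module Defs where

open import Data.Nat as ℕ using (ℕ; zero; suc; NonZero; _%_)
open import Data.Nat.Properties using (m*n≢0)
open import Data.Nat.Combinatorics using (_C_)
open import Data.Integer as ℤ using (ℤ; +_)
open import Data.Integer.Divisibility using (_∣_)
open import Data.Bool using (Bool; true; false; if_then_else_)
open import Data.Vec using (Vec; []; _∷_; map; sum; zipWith; lookup)
open import Data.Fin using (Fin)
open import Data.Fin.Subset using (Subset; ∣_∣)
open import Data.Product using (_×_; ∃)
open import Data.Sum using (_⊎_)
open import Relation.Binary.PropositionalEquality using (_≡_)
open import Function using (_∘_)

N : ℕ → ℕ → ℕ
N m n = m ℕ.* n

gmn : ℕ → ℕ → ℤ
gmn m n = (+ (m ℕ.* (n C 2)) ℤ.- + n) ℤ.+ + 1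

InD : (m n : ℕ) → Vec ℕ n → Set
InD m n x = (∀ (i : Fin n) → lookup x i ℕ.< N m n)
          × ((+ N m n) ∣ (+ sum x ℤ.- gmn m n))

shift : (m n : ℕ) .{{_ : NonZero m}} .{{_ : NonZero n}} → Vec ℕ n → Vec ℕ n
shift m n x = map (λ t → _%_ (t ℕ.+ m) (m ℕ.* n) {{m*n≢0 m n}}) x

shift^ : (m n : ℕ) .{{_ : NonZero m}} .{{_ : NonZero n}} → ℕ → Vec ℕ n → Vec ℕ n
shift^ m n zero    x = x
shift^ m n (suc j) x = shift m n (shift^ m n j x)

ShiftEquiv : (m n : ℕ) .{{_ : NonZero m}} .{{_ : NonZero n}} → Vec ℕ n → Vec ℕ n → Set
ShiftEquiv m n x y = ∃ λ j → (shift^ m n j x ≡ y) ⊎ (shift^ m n j y ≡ x)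

sumOn : ∀ {n} → Subset n → Vec ℕ n → ℕ
sumOn S D = sum (zipWith (λ b d → if b then d else 0) S D)

-- genus of the induced subgraph of K_n^m on k vertices:
-- |E| - |V| + 1 = m * C(k,2) - k + 1
genusInduced : (m k : ℕ) → ℤ
genusInduced m k = (+ (m ℕ.* (k C 2)) ℤ.- + k) ℤ.+ + 1

-- break divisors on K_n^m (divisors with entries ≥ 0 are represented over ℕ);
-- induced subgraphs = induced on nonempty vertex subsets S
Break : (m n : ℕ) → Vec ℕ n → Set
Break m n D = (+ sum D ≡ gmn m n)
            × (∀ (S : Subset n) → 1 ℕ.≤ ∣ S ∣ → genusInduced m ∣ S ∣ ℤ.≤ + sumOn S D)

-- Put N = m n and G m k = m (k choose 2) + 1, the genus of K_k^m plus k.  Adding the size of a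
-- vertex set to both sides turns every break-divisor condition into an inequality over ℕ.
--
-- Along n consecutive shifts an entry with residue r modulo m takes each value r + j m
-- (j < n) once, so the n values of sum + n average at most G m n + N - 1; since they are all
-- congruent to G m n modulo N, one shift y has sum y + n + N e = G m n for some e.  Now weaken the
-- subset inequalities by a slack d, starting from d = G m n, and remove one unit of slack at a time.
-- If some set violates the inequalities with slack d, a largest such S is tight for slack d + 1.  If
-- S contains every vertex, tightness forces e > 0 and one shift raises every entry by m without
-- wrapping.  Otherwise tightness and maximality of S show that under |∁ S| further shifts exactly
-- the entries outside S wrap around, which keeps the sum and restores all inequalities with slack d.
--
-- If a and shiftᵗ a are break divisors with 0 < t < n, equal sums force exactly t
-- entries W to wrap, and adding the inequality of shiftᵗ a on W to that of a on ∁ W gives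
-- G m t + G m (n - t) ≤ G m n - m t (n - t), against G m n + 1 = G m t + G m (n - t) + m t (n - t).

module Submission where

open import Defs
open import Data.Nat using (ℕ; NonZero)
open import Data.Vec using (Vec)
open import Data.Product using (_×_; ∃)
open import Relation.Binary.PropositionalEquality using (_≡_)

open import Data.Bool using (Bool; true; false)
open import Data.Empty using (⊥; ⊥-elim)
open import Data.Fin using (Fin; zero; suc)
open import Data.Fin.Subset using (Subset; ∣_∣; ⊤; ⁅_⁆; ∁; _∩_; _∪_; _∈_; _∉_) renaming (⊥ to ∅)
open import Data.Fin.Subset.Properties
  using (⊆-antisym; p∩q⊆q; x∈p∩q⁺; x∈⁅y⁆⇒x≡y; ∩-comm; ∩-idem; ∩-identityˡ; ∩-zeroʳ; ∣⊤∣≡n; ∣⊥∣≡0;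
         ∣⁅x⁆∣≡1; ∣p∩q∣≤∣q∣; ∣p∣≤n; ∣p∣≡n⇒p≡⊤; ∈⊤; ∉⊥; x∉∁p⇒x∈p; anySubset?)
open import Data.Integer as ℤ using (ℤ; _⊖_)
import Data.Integer.Properties as ℤ
open import Data.Integer.Divisibility using (_∣_)
import Data.Integer.Tactic.RingSolver as ℤ-Solver
open import Data.Nat as ℕ
  using (zero; suc; _+_; _*_; _∸_; _≤_; _≰_; _<_; z≤n; s≤s; _%_; _/_; _≤?_; _<?_; _≟_; >-nonZero⁻¹)
open import Data.Nat.Combinatorics using (_C_; nC1≡n; nCk+nC[k+1]≡[n+1]C[k+1])
open import Data.Nat.Divisibility using (divides)
open import Data.Nat.DivMod
open import Data.Nat.Properties
open import Data.Nat.Tactic.RingSolver using (solve-∀)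
open import Algebra.Properties.CommutativeSemigroup +-commutativeSemigroup
  using (x∙yz≈y∙xz; xy∙z≈xz∙y; interchange)
open import Data.Product using (_,_; ∃₂; proj₁; proj₂)
import Data.Product as Product
open import Data.Sum using (inj₁; inj₂)
open import Data.Vec using ([]; _∷_; sum; lookup; tabulate; map)
open import Data.Vec.Properties
  using (lookup-map; lookup∘tabulate; tabulate∘lookup; tabulate-cong; []=⇒lookup; lookup⇒[]=)
open import Function using (_∘_)
open import Relation.Binary.PropositionalEquality
  using (_≢_; refl; sym; trans; cong; cong₂; subst; subst₂; module ≡-Reasoning)
open import Relation.Nullary using (Dec; ¬_; yes; no; does; contradiction)
open import Relation.Nullary.Decidable using (_×-dec_)

toℕ : Bool → ℕ
toℕ false = 0
toℕ true  = 1

sumOn-⊤ : ∀ {n} (y : Vec ℕ n) → sumOn ⊤ y ≡ sum y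
sumOn-⊤ []      = refl
sumOn-⊤ (v ∷ y) = cong (v +_) (sumOn-⊤ y)

sumOn-∅ : ∀ {n} (y : Vec ℕ n) → sumOn ∅ y ≡ 0
sumOn-∅ []      = refl
sumOn-∅ (v ∷ y) = sumOn-∅ y

sumOn-∩∁ : ∀ {n} (A S : Subset n) (y : Vec ℕ n) →
           sumOn A y ≡ sumOn (A ∩ S) y + sumOn (A ∩ ∁ S) y
sumOn-∩∁ []          []          []      = refl
sumOn-∩∁ (true ∷ A)  (true ∷ S)  (v ∷ y) =
  trans (cong (v +_) (sumOn-∩∁ A S y)) (sym (+-assoc v _ _))
sumOn-∩∁ (true ∷ A)  (false ∷ S) (v ∷ y) =
  trans (cong (v +_) (sumOn-∩∁ A S y)) (x∙yz≈y∙xz v (sumOn (A ∩ S) y) (sumOn (A ∩ ∁ S) y))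
sumOn-∩∁ (false ∷ A) (_ ∷ S)     (v ∷ y) = sumOn-∩∁ A S y

∣∣-∩∁ : ∀ {n} (A S : Subset n) → ∣ A ∣ ≡ ∣ A ∩ S ∣ + ∣ A ∩ ∁ S ∣
∣∣-∩∁ []          []          = refl
∣∣-∩∁ (true ∷ A)  (true ∷ S)  = cong suc (∣∣-∩∁ A S)
∣∣-∩∁ (true ∷ A)  (false ∷ S) = trans (cong suc (∣∣-∩∁ A S)) (sym (+-suc _ _))
∣∣-∩∁ (false ∷ A) (_ ∷ S)     = ∣∣-∩∁ A S

sumOn-∪∩∁ : ∀ {n} (A S : Subset n) (y : Vec ℕ n) →
            sumOn (S ∪ (A ∩ ∁ S)) y ≡ sumOn S y + sumOn (A ∩ ∁ S) y
sumOn-∪∩∁ []          []          []      = refl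
sumOn-∪∩∁ (true ∷ A)  (true ∷ S)  (v ∷ y) =
  trans (cong (v +_) (sumOn-∪∩∁ A S y)) (sym (+-assoc v _ _))
sumOn-∪∩∁ (false ∷ A) (true ∷ S)  (v ∷ y) =
  trans (cong (v +_) (sumOn-∪∩∁ A S y)) (sym (+-assoc v _ _))
sumOn-∪∩∁ (true ∷ A)  (false ∷ S) (v ∷ y) =
  trans (cong (v +_) (sumOn-∪∩∁ A S y)) (x∙yz≈y∙xz v (sumOn S y) (sumOn (A ∩ ∁ S) y))
sumOn-∪∩∁ (false ∷ A) (false ∷ S) (v ∷ y) = sumOn-∪∩∁ A S y

∣∣-∪∩∁ : ∀ {n} (A S : Subset n) → ∣ S ∪ (A ∩ ∁ S) ∣ ≡ ∣ S ∣ + ∣ A ∩ ∁ S ∣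
∣∣-∪∩∁ []          []          = refl
∣∣-∪∩∁ (true ∷ A)  (true ∷ S)  = cong suc (∣∣-∪∩∁ A S)
∣∣-∪∩∁ (false ∷ A) (true ∷ S)  = cong suc (∣∣-∪∩∁ A S)
∣∣-∪∩∁ (true ∷ A)  (false ∷ S) = trans (cong suc (∣∣-∪∩∁ A S)) (sym (+-suc _ _))
∣∣-∪∩∁ (false ∷ A) (false ∷ S) = ∣∣-∪∩∁ A S

sumOn-⁅⁆ : ∀ {n} (i : Fin n) (y : Vec ℕ n) → sumOn ⁅ i ⁆ y ≡ lookup y i
sumOn-⁅⁆ zero    (v ∷ y) = trans (cong (v +_) (sumOn-∅ y)) (+-identityʳ v)
sumOn-⁅⁆ (suc i) (v ∷ y) = sumOn-⁅⁆ i y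

∩-⁅⁆ : ∀ {n} {i : Fin n} {S : Subset n} → i ∈ S → S ∩ ⁅ i ⁆ ≡ ⁅ i ⁆
∩-⁅⁆ {i = i} {S} i∈S = ⊆-antisym (p∩q⊆q S ⁅ i ⁆) λ j∈⁅i⁆ →
  x∈p∩q⁺ (subst (_∈ S) (sym (x∈⁅y⁆⇒x≡y i j∈⁅i⁆)) i∈S , j∈⁅i⁆)

sumOn-remove : ∀ {n} {i : Fin n} {S : Subset n} (y : Vec ℕ n) → i ∈ S →
               sumOn S y ≡ lookup y i + sumOn (S ∩ ∁ ⁅ i ⁆) y
sumOn-remove {i = i} {S} y i∈S = trans (sumOn-∩∁ S ⁅ i ⁆ y)
  (cong (_+ sumOn (S ∩ ∁ ⁅ i ⁆) y) (trans (cong (λ A → sumOn A y) (∩-⁅⁆ i∈S)) (sumOn-⁅⁆ i y)))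

∣∣-remove : ∀ {n} {i : Fin n} {S : Subset n} → i ∈ S → ∣ S ∣ ≡ suc ∣ S ∩ ∁ ⁅ i ⁆ ∣
∣∣-remove {i = i} {S} i∈S = trans (∣∣-∩∁ S ⁅ i ⁆)
  (cong (_+ ∣ S ∩ ∁ ⁅ i ⁆ ∣) (trans (cong ∣_∣ (∩-⁅⁆ i∈S)) (∣⁅x⁆∣≡1 i)))

sumOn-carry : ∀ {n} (N c : ℕ) (T : Subset n) {y y′ : Vec ℕ n} →
              (∀ i → lookup y′ i + N * toℕ (lookup T i) ≡ lookup y i + c) →
              ∀ A → sumOn A y′ + N * ∣ A ∩ T ∣ ≡ sumOn A y + c * ∣ A ∣
sumOn-carry N c [] {[]} {[]} _ [] = trans (*-zeroʳ N) (sym (*-zeroʳ c))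
sumOn-carry N c (t ∷ T) {v ∷ y} {v′ ∷ y′} carry (false ∷ A) =
  sumOn-carry N c T (carry ∘ suc) A
sumOn-carry N c (t ∷ T) {v ∷ y} {v′ ∷ y′} carry (true ∷ A) = begin
  v′ + sumOn A y′ + N * ∣ t ∷ (A ∩ T) ∣
    ≡⟨ cong (λ k → v′ + sumOn A y′ + N * k) (∣∷∣ t (A ∩ T)) ⟩
  v′ + sumOn A y′ + N * (toℕ t + ∣ A ∩ T ∣)
    ≡⟨ regroup v′ (sumOn A y′) N (toℕ t) ∣ A ∩ T ∣ ⟩
  (v′ + N * toℕ t) + (sumOn A y′ + N * ∣ A ∩ T ∣)
    ≡⟨ cong₂ _+_ (carry zero) (sumOn-carry N c T (carry ∘ suc) A) ⟩
  (v + c) + (sumOn A y + c * ∣ A ∣)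
    ≡⟨ regroup′ v c (sumOn A y) ∣ A ∣ ⟩
  v + sumOn A y + c * suc ∣ A ∣ ∎
  where
  open ≡-Reasoning
  ∣∷∣ : ∀ {k} b (p : Subset k) → ∣ b ∷ p ∣ ≡ toℕ b + ∣ p ∣
  ∣∷∣ true  p = refl
  ∣∷∣ false p = refl
  regroup : ∀ a s N b k → a + s + N * (b + k) ≡ (a + N * b) + (s + N * k)
  regroup = solve-∀
  regroup′ : ∀ a c s k → (a + c) + (s + c * k) ≡ a + s + c * suc k
  regroup′ = solve-∀

C2-suc : ∀ k → suc k C 2 ≡ k C 2 + k
C2-suc k = begin
  suc k C 2         ≡⟨ nCk+nC[k+1]≡[n+1]C[k+1] k 1 ⟨
  k C 1 + k C 2     ≡⟨ cong (_+ k C 2) (nC1≡n k) ⟩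
  k + k C 2         ≡⟨ +-comm k (k C 2) ⟩
  k C 2 + k         ∎
  where open ≡-Reasoning

C2-+ : ∀ p q → (p + q) C 2 ≡ p C 2 + q C 2 + p * q
C2-+ p zero = begin
  (p + 0) C 2             ≡⟨ cong (_C 2) (+-identityʳ p) ⟩
  p C 2                   ≡⟨ pad (p C 2) p ⟩
  p C 2 + 0 + p * 0       ∎
  where
  open ≡-Reasoning
  pad : ∀ c p → c ≡ c + 0 + p * 0
  pad = solve-∀
C2-+ p (suc q) = begin
  (p + suc q) C 2                 ≡⟨ cong (_C 2) (+-suc p q) ⟩
  suc (p + q) C 2                 ≡⟨ C2-suc (p + q) ⟩
  (p + q) C 2 + (p + q)           ≡⟨ cong (_+ (p + q)) (C2-+ p q) ⟩
  p C 2 + q C 2 + p * q + (p + q) ≡⟨ regroup (p C 2) (q C 2) p q ⟩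
  p C 2 + (q C 2 + q) + p * suc q ≡⟨ cong (λ c → p C 2 + c + p * suc q) (C2-suc q) ⟨
  p C 2 + suc q C 2 + p * suc q   ∎
  where
  open ≡-Reasoning
  regroup : ∀ a b p q → a + b + p * q + (p + q) ≡ a + (b + q) + p * suc q
  regroup = solve-∀

C2-mono : ∀ {k l} → k ≤ l → k C 2 ≤ l C 2
C2-mono z≤n = z≤n
C2-mono (s≤s {k} {l} k≤l) =
  subst₂ _≤_ (sym (C2-suc k)) (sym (C2-suc l)) (+-mono-≤ (C2-mono k≤l) k≤l)

G : ℕ → ℕ → ℕ
G m k = m * (k C 2) + 1

G-0 : ∀ m → G m 0 ≡ 1
G-0 m = cong (_+ 1) (*-zeroʳ m)

G-1 : ∀ m → G m 1 ≡ 1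
G-1 m = cong (_+ 1) (*-zeroʳ m)

G-suc : ∀ m k → G m (suc k) ≡ G m k + m * k
G-suc m k = trans (cong (λ c → m * c + 1) (C2-suc k)) (regroup m (k C 2) k)
  where
  regroup : ∀ m c k → m * (c + k) + 1 ≡ m * c + 1 + m * k
  regroup = solve-∀

G-+ : ∀ m p q → G m (p + q) + 1 ≡ G m p + G m q + m * (p * q)
G-+ m p q = trans (cong (λ c → m * c + 1 + 1) (C2-+ p q)) (regroup m (p C 2) (q C 2) (p * q))
  where
  regroup : ∀ m a b c → m * (a + b + c) + 1 + 1 ≡ m * a + 1 + (m * b + 1) + m * c
  regroup = solve-∀

G-mono : ∀ m {k l} → k ≤ l → G m k ≤ G m l
G-mono m k≤l = +-monoˡ-≤ 1 (*-monoʳ-≤ m (C2-mono k≤l))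

genusInduced≡G-size : ∀ m k → genusInduced m k ≡ ℤ.+ G m k ℤ.- ℤ.+ k
genusInduced≡G-size m k = regroup (ℤ.+ (m * (k C 2))) (ℤ.+ k)
  where
  regroup : ∀ (a k : ℤ) → (a ℤ.- k) ℤ.+ ℤ.1ℤ ≡ (a ℤ.+ ℤ.1ℤ) ℤ.- k
  regroup = ℤ-Solver.solve-∀

genusInduced+size : ∀ m k → genusInduced m k ℤ.+ ℤ.+ k ≡ ℤ.+ G m k
genusInduced+size m k = trans (cong (ℤ._+ ℤ.+ k) (genusInduced≡G-size m k)) (cancel (ℤ.+ G m k) (ℤ.+ k))
  where
  cancel : ∀ (a k : ℤ) → a ℤ.- k ℤ.+ k ≡ a
  cancel = ℤ-Solver.solve-∀

genusInduced≤⇒G≤ : ∀ m k s → genusInduced m k ℤ.≤ ℤ.+ s → G m k ≤ s + k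
genusInduced≤⇒G≤ m k s h =
  ℤ.drop‿+≤+ (subst (ℤ._≤ ℤ.+ (s + k)) (genusInduced+size m k) (ℤ.+-monoˡ-≤ (ℤ.+ k) h))

G≤⇒genusInduced≤ : ∀ m k s → G m k ≤ s + k → genusInduced m k ℤ.≤ ℤ.+ s
G≤⇒genusInduced≤ m k s h =
  subst₂ ℤ._≤_ (sym (genusInduced≡G-size m k)) (cancel (ℤ.+ s) (ℤ.+ k))
    (ℤ.+-monoˡ-≤ (ℤ.- ℤ.+ k) (ℤ.+≤+ h))
  where
  cancel : ∀ (s k : ℤ) → s ℤ.+ k ℤ.- k ≡ s
  cancel = ℤ-Solver.solve-∀

≡genusInduced⇒≡G : ∀ m k s → ℤ.+ s ≡ genusInduced m k → s + k ≡ G m k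
≡genusInduced⇒≡G m k s h =
  ℤ.+-injective (trans (cong (ℤ._+ ℤ.+ k) h) (genusInduced+size m k))

≡G⇒≡genusInduced : ∀ m k s → s + k ≡ G m k → ℤ.+ s ≡ genusInduced m k
≡G⇒≡genusInduced m k s h = begin
  ℤ.+ s                       ≡⟨ cancel (ℤ.+ s) (ℤ.+ k) ⟨
  ℤ.+ (s + k) ℤ.- ℤ.+ k       ≡⟨ cong (λ a → ℤ.+ a ℤ.- ℤ.+ k) h ⟩
  ℤ.+ G m k ℤ.- ℤ.+ k         ≡⟨ genusInduced≡G-size m k ⟨
  genusInduced m k            ∎
  where
  open ≡-Reasoning
  cancel : ∀ (s k : ℤ) → s ℤ.+ k ℤ.- k ≡ s
  cancel = ℤ-Solver.solve-∀

∣⊖⇒≡-mod : ∀ {N a b} → ℤ.+ N ∣ a ⊖ b → ∃₂ λ p q → a + N * p ≡ b + N * q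
∣⊖⇒≡-mod {N} {a} {b} (divides k ∣a⊖b∣≡kN) with ≤-total b a
... | inj₁ b≤a = 0 , k , (begin
  a + N * 0         ≡⟨ cong (a +_) (*-zeroʳ N) ⟩
  a + 0             ≡⟨ +-identityʳ a ⟩
  a                 ≡⟨ m+[n∸m]≡n b≤a ⟨
  b + (a ∸ b)       ≡⟨ cong (b +_) (trans (sym (ℤ.∣⊖∣-≤ b≤a)) (trans (ℤ.∣m⊖n∣≡∣n⊖m∣ b a) ∣a⊖b∣≡kN)) ⟩
  b + k * N         ≡⟨ cong (b +_) (*-comm k N) ⟩
  b + N * k         ∎)
  where open ≡-Reasoning
... | inj₂ a≤b = k , 0 , (begin
  a + N * k         ≡⟨ cong (a +_) (*-comm N k) ⟩
  a + k * N         ≡⟨ cong (a +_) (trans (sym ∣a⊖b∣≡kN) (ℤ.∣⊖∣-≤ a≤b)) ⟩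
  a + (b ∸ a)       ≡⟨ m+[n∸m]≡n a≤b ⟩
  b                 ≡⟨ +-identityʳ b ⟨
  b + 0             ≡⟨ cong (b +_) (*-zeroʳ N) ⟨
  b + N * 0         ∎)
  where open ≡-Reasoning

≡-mod-below : ∀ {N Y Z p q} → Y + N * p ≡ Z + N * q → Y < Z + N → ∃ λ e → Y + N * e ≡ Z
≡-mod-below {N} {Y} {Z} {p} {q} eq Y<Z+N with q ≤? p
... | yes q≤p = p ∸ q , +-cancelʳ-≡ (N * q) (Y + N * (p ∸ q)) Z (begin
  Y + N * (p ∸ q) + N * q    ≡⟨ +-assoc Y _ _ ⟩
  Y + (N * (p ∸ q) + N * q)  ≡⟨ cong (Y +_) (*-distribˡ-+ N (p ∸ q) q) ⟨
  Y + N * (p ∸ q + q)        ≡⟨ cong (λ k → Y + N * k) (m∸n+n≡m q≤p) ⟩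
  Y + N * p                  ≡⟨ eq ⟩
  Z + N * q                  ∎)
  where open ≡-Reasoning
... | no q≰p = contradiction Y<Z+N (≤⇒≯ (+-cancelʳ-≤ (N * p) (Z + N) Y (begin
  Z + N + N * p              ≡⟨ trans (+-assoc Z N (N * p)) (cong (Z +_) (sym (*-suc N p))) ⟩
  Z + N * suc p              ≤⟨ +-monoʳ-≤ Z (*-monoʳ-≤ N (≰⇒> q≰p)) ⟩
  Z + N * q                  ≡⟨ eq ⟨
  Y + N * p                  ∎)))
  where open ≤-Reasoning

%-below : ∀ {N v} .{{_ : NonZero N}} → v < N → v % N + N * toℕ false ≡ v
%-below {N} {v} v<N = trans (cong₂ _+_ (m<n⇒m%n≡m v<N) (*-zeroʳ N)) (+-identityʳ v)

%-above : ∀ {N v} .{{_ : NonZero N}} → N ≤ v → v < N + N → v % N + N * toℕ true ≡ v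
%-above {N} {v} N≤v v<2N = begin
  v % N + N * 1       ≡⟨ cong₂ _+_ (m≤n⇒[n∸m]%m≡n%m N≤v) (sym (*-identityʳ N)) ⟨
  (v ∸ N) % N + N     ≡⟨ cong (_+ N) (m<n⇒m%n≡m v∸N<N) ⟩
  v ∸ N + N           ≡⟨ m∸n+n≡m N≤v ⟩
  v                   ∎
  where
  open ≡-Reasoning
  v∸N<N : v ∸ N < N
  v∸N<N = subst (v ∸ N <_) (m+n∸n≡m N N) (∸-monoˡ-< v<2N N≤v)

%-carry : ∀ {N v} .{{_ : NonZero N}} → v < N + N → (N≤?v : Dec (N ≤ v)) →
          v % N + N * toℕ (does N≤?v) ≡ v
%-carry v<2N (yes N≤v) = %-above N≤v v<2N
%-carry v<2N (no  N≰v) = %-below (≰⇒> N≰v)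

%-absorbˡ : ∀ a b N .{{_ : NonZero N}} → (a % N + b) % N ≡ (a + b) % N
%-absorbˡ a b N = begin
  (a % N + b) % N           ≡⟨ %-distribˡ-+ (a % N) b N ⟩
  (a % N % N + b % N) % N   ≡⟨ cong (λ v → (v + b % N) % N) (m%n%n≡m%n a N) ⟩
  (a % N + b % N) % N       ≡⟨ %-distribˡ-+ a b N ⟨
  (a + b) % N               ∎
  where open ≡-Reasoning

vec-ext : ∀ {n} {u v : Vec ℕ n} → (∀ i → lookup u i ≡ lookup v i) → u ≡ v
vec-ext {u = u} {v} u≗v =
  trans (sym (tabulate∘lookup u)) (trans (tabulate-cong u≗v) (tabulate∘lookup v))

module Shift (m n : ℕ) .{{_ : NonZero m}} .{{_ : NonZero n}} where

  instance
    NonZero-mn : NonZero (m * n)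
    NonZero-mn = m*n≢0 m n

  Bounded : Vec ℕ n → Set
  Bounded y = ∀ i → lookup y i < m * n

  shift^-lookup : ∀ s {y} → Bounded y → ∀ i →
                  lookup (shift^ m n s y) i ≡ (lookup y i + s * m) % (m * n)
  shift^-lookup zero    {y} by i =
    sym (trans (cong (_% (m * n)) (+-identityʳ (lookup y i))) (m<n⇒m%n≡m (by i)))
  shift^-lookup (suc s) {y} by i = begin
    lookup (shift m n (shift^ m n s y)) i          ≡⟨ lookup-map i _ (shift^ m n s y) ⟩
    (lookup (shift^ m n s y) i + m) % (m * n)      ≡⟨ cong (λ v → (v + m) % (m * n)) (shift^-lookup s by i) ⟩
    ((lookup y i + s * m) % (m * n) + m) % (m * n) ≡⟨ %-absorbˡ (lookup y i + s * m) m (m * n) ⟩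
    (lookup y i + s * m + m) % (m * n)             ≡⟨ cong (_% (m * n)) (+-assoc (lookup y i) (s * m) m) ⟩
    (lookup y i + (s * m + m)) % (m * n)           ≡⟨ cong (λ k → (lookup y i + k) % (m * n)) (+-comm (s * m) m) ⟩
    (lookup y i + suc s * m) % (m * n)             ∎
    where open ≡-Reasoning

  shift^-bounded : ∀ s {y} → Bounded y → Bounded (shift^ m n s y)
  shift^-bounded s by i = subst (_< m * n) (sym (shift^-lookup s by i)) (m%n<n _ (m * n))

  shift^-+ : ∀ p q y → shift^ m n (p + q) y ≡ shift^ m n p (shift^ m n q y)
  shift^-+ zero    q y = refl
  shift^-+ (suc p) q y = cong (shift m n) (shift^-+ p q y)

  shift^-*n : ∀ q {y} → Bounded y → shift^ m n (q * n) y ≡ y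
  shift^-*n q {y} by = vec-ext λ i → begin
    lookup (shift^ m n (q * n) y) i         ≡⟨ shift^-lookup (q * n) by i ⟩
    (lookup y i + q * n * m) % (m * n)      ≡⟨ cong (λ k → (lookup y i + k) % (m * n)) (qnm≡q[mn] q n m) ⟩
    (lookup y i + q * (m * n)) % (m * n)    ≡⟨ [m+kn]%n≡m%n (lookup y i) q (m * n) ⟩
    lookup y i % (m * n)                    ≡⟨ m<n⇒m%n≡m (by i) ⟩
    lookup y i                              ∎
    where
    open ≡-Reasoning
    qnm≡q[mn] : ∀ q n m → q * n * m ≡ q * (m * n)
    qnm≡q[mn] = solve-∀

  shift^-%n : ∀ t {y} → Bounded y → shift^ m n t y ≡ shift^ m n (t % n) y
  shift^-%n t {y} by = begin
    shift^ m n t y                                  ≡⟨ cong (λ k → shift^ m n k y) (m≡m%n+[m/n]*n t n) ⟩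
    shift^ m n (t % n + t / n * n) y                ≡⟨ shift^-+ (t % n) (t / n * n) y ⟩
    shift^ m n (t % n) (shift^ m n (t / n * n) y)   ≡⟨ cong (shift^ m n (t % n)) (shift^-*n (t / n) by) ⟩
    shift^ m n (t % n) y                            ∎
    where open ≡-Reasoning

  shift^-inverse : ∀ s {y} → Bounded y → shift^ m n (s * (n ∸ 1)) (shift^ m n s y) ≡ y
  shift^-inverse s {y} by = begin
    shift^ m n (s * (n ∸ 1)) (shift^ m n s y)   ≡⟨ shift^-+ (s * (n ∸ 1)) s y ⟨
    shift^ m n (s * (n ∸ 1) + s) y              ≡⟨ cong (λ k → shift^ m n k y) (s[n-1]+s≡sn s) ⟩
    shift^ m n (s * n) y                        ≡⟨ shift^-*n s by ⟩
    y                                           ∎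
    where
    open ≡-Reasoning
    s[n-1]+s≡sn : ∀ s → s * (n ∸ 1) + s ≡ s * n
    s[n-1]+s≡sn s = begin
      s * (n ∸ 1) + s    ≡⟨ trans (+-comm (s * (n ∸ 1)) s) (sym (*-suc s (n ∸ 1))) ⟩
      s * suc (n ∸ 1)    ≡⟨ cong (s *_) (m+[n∸m]≡n (>-nonZero⁻¹ n)) ⟩
      s * n              ∎

  -- T is the set of entries that wrap around modulo m n when y is shifted t times.
  Carries : ℕ → Vec ℕ n → Subset n → Set
  Carries t y T = ∀ i → lookup (shift^ m n t y) i + m * n * toℕ (lookup T i) ≡ lookup y i + t * m

  carries-intro : ∀ {t y} (T : Subset n) → Bounded y → t * m < m * n →
                  (∀ {i} → i ∈ T → m * n ≤ lookup y i + t * m) →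
                  (∀ {i} → i ∉ T → lookup y i + t * m < m * n) → Carries t y T
  carries-intro {t} {y} T by tm<N wraps stays i =
    trans (cong (_+ m * n * toℕ (lookup T i)) (shift^-lookup t by i)) (carry (lookup T i) refl)
    where
    carry : ∀ b → lookup T i ≡ b → (lookup y i + t * m) % (m * n) + m * n * toℕ b ≡ lookup y i + t * m
    carry true  T[i] = %-above (wraps (lookup⇒[]= i T T[i])) (+-mono-< (by i) tm<N)
    carry false T[i] = %-below (stays λ i∈T → true≢false (trans (sym ([]=⇒lookup i∈T)) T[i]))
      where
      true≢false : true ≢ false
      true≢false ()

  carrySet : ℕ → Vec ℕ n → Subset n
  carrySet t y = tabulate λ i → does (m * n ≤? lookup y i + t * m)

  carries-carrySet : ∀ t {y} → Bounded y → t * m < m * n → Carries t y (carrySet t y)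
  carries-carrySet t {y} by tm<N i = begin
    lookup (shift^ m n t y) i + m * n * toℕ (lookup (carrySet t y) i)
      ≡⟨ cong₂ (λ a b → a + m * n * toℕ b) (shift^-lookup t by i) (lookup∘tabulate _ i) ⟩
    (lookup y i + t * m) % (m * n) + m * n * toℕ (does (m * n ≤? lookup y i + t * m))
      ≡⟨ %-carry (+-mono-< (by i) tm<N) (m * n ≤? lookup y i + t * m) ⟩
    lookup y i + t * m ∎
    where open ≡-Reasoning

  carries-sumOn : ∀ {t y T} → Carries t y T → ∀ A →
                  sumOn A (shift^ m n t y) + m * n * ∣ A ∩ T ∣ ≡ sumOn A y + t * m * ∣ A ∣
  carries-sumOn {t} {T = T} = sumOn-carry (m * n) (t * m) T

  carries-sum : ∀ {t y T} → Carries t y T → sum (shift^ m n t y) + m * n * ∣ T ∣ ≡ sum y + t * m * n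
  carries-sum {t} {y} {T} c =
    subst₂ _≡_ (cong₂ (λ s k → s + m * n * ∣ k ∣) (sumOn-⊤ (shift^ m n t y)) (∩-identityˡ T))
               (cong₂ (λ s k → s + t * m * k) (sumOn-⊤ y) (∣⊤∣≡n n))
               (carries-sumOn {t} c ⊤)

sumBelow : ℕ → (ℕ → ℕ) → ℕ
sumBelow zero    f = 0
sumBelow (suc k) f = sumBelow k f + f k

syntax sumBelow k (λ s → e) = ∑[ s < k ] e

∑-+ : ∀ k (f g : ℕ → ℕ) → ∑[ s < k ] (f s + g s) ≡ ∑[ s < k ] f s + ∑[ s < k ] g s
∑-+ zero    f g = refl
∑-+ (suc k) f g =
  trans (cong (_+ (f k + g k)) (∑-+ k f g)) (interchange (sumBelow k f) (sumBelow k g) (f k) (g k))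

∑-const : ∀ k c → ∑[ s < k ] c ≡ k * c
∑-const zero    c = refl
∑-const (suc k) c = trans (cong (_+ c) (∑-const k c)) (+-comm (k * c) c)

∑-cong : ∀ k {f g : ℕ → ℕ} → (∀ {s} → s < k → f s ≡ g s) → ∑[ s < k ] f s ≡ ∑[ s < k ] g s
∑-cong zero    f≗g = refl
∑-cong (suc k) {f} {g} f≗g = cong₂ _+_ (∑-cong k {f} {g} (f≗g ∘ m<n⇒m<1+n)) (f≗g ≤-refl)

∑-rotate : ∀ k (f : ℕ → ℕ) → ∑[ s < k ] f (suc s) + f 0 ≡ ∑[ s < k ] f s + f k
∑-rotate zero    f = refl
∑-rotate (suc k) f = begin
  ∑[ s < k ] f (suc s) + f (suc k) + f 0   ≡⟨ xy∙z≈xz∙y (sumBelow k (f ∘ suc)) (f (suc k)) (f 0) ⟩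
  ∑[ s < k ] f (suc s) + f 0 + f (suc k)   ≡⟨ cong (_+ f (suc k)) (∑-rotate k f) ⟩
  ∑[ s < k ] f s + f k + f (suc k)         ∎
  where open ≡-Reasoning

∑-arithmetic : ∀ k r d → ∑[ s < k ] (r + s * d) ≡ k * r + d * (k C 2)
∑-arithmetic zero    r d = sym (*-zeroʳ d)
∑-arithmetic (suc k) r d = begin
  ∑[ s < k ] (r + s * d) + (r + k * d)   ≡⟨ cong (_+ (r + k * d)) (∑-arithmetic k r d) ⟩
  k * r + d * (k C 2) + (r + k * d)      ≡⟨ regroup k r d (k C 2) ⟩
  suc k * r + d * (k C 2 + k)            ≡⟨ cong (λ c → suc k * r + d * c) (C2-suc k) ⟨
  suc k * r + d * (suc k C 2)            ∎
  where
  open ≡-Reasoning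
  regroup : ∀ k r d c → k * r + d * c + (r + k * d) ≡ suc k * r + d * (c + k)
  regroup = solve-∀

∑-sum-map : ∀ k (F : ℕ → ℕ → ℕ) {l} (xs : Vec ℕ l) →
            ∑[ s < k ] sum (map (λ v → F v s) xs) ≡ sum (map (λ v → ∑[ s < k ] F v s) xs)
∑-sum-map k F []       = trans (∑-const k 0) (*-zeroʳ k)
∑-sum-map k F (v ∷ xs) = trans (∑-+ k (F v) (λ s → sum (map (λ v → F v s) xs))) (cong (sumBelow k (F v) +_) (∑-sum-map k F xs))

sum-map-≤ : ∀ (h : ℕ → ℕ) {c B} → (∀ v → h v + c ≤ B) → ∀ {l} (xs : Vec ℕ l) →
            sum (map h xs) + l * c ≤ l * B
sum-map-≤ h h+c≤B []           = ≤-refl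
sum-map-≤ h {c} {B} h+c≤B {suc l} (v ∷ xs) =
  subst (_≤ B + l * B) (interchange (h v) c (sum (map h xs)) (l * c)) (+-mono-≤ (h+c≤B v) (sum-map-≤ h h+c≤B xs))

pigeonhole : ∀ k .{{_ : NonZero k}} (g : ℕ → ℕ) B → ∑[ s < k ] g s ≤ k * B →
             ∃ λ s → s < k × g s ≤ B
pigeonhole (suc k) g B = go k
  where
  go : ∀ j → ∑[ s < suc j ] g s ≤ suc j * B → ∃ λ s → s < suc j × g s ≤ B
  go zero    ∑≤ = 0 , s≤s z≤n , subst (g 0 ≤_) (+-identityʳ B) ∑≤
  go (suc j) ∑≤ with g (suc j) ≤? B
  ... | yes g≤B = suc j , ≤-refl , g≤B
  ... | no  g≰B = Product.map₂ (Product.map₁ m<n⇒m<1+n) (go j ∑≤′)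
    where
    ∑≤′ : ∑[ s < suc j ] g s ≤ suc j * B
    ∑≤′ = +-cancelˡ-≤ B _ _ (begin
      B + ∑[ s < suc j ] g s          ≡⟨ +-comm B _ ⟩
      ∑[ s < suc j ] g s + B          ≤⟨ +-monoʳ-≤ (sumBelow (suc j) g) (<⇒≤ (≰⇒> g≰B)) ⟩
      ∑[ s < suc (suc j) ] g s        ≤⟨ ∑≤ ⟩
      B + suc j * B                   ∎)
      where open ≤-Reasoning

module Averaging (m n : ℕ) .{{_ : NonZero m}} .{{_ : NonZero n}} where
  open Shift m n

  orbitValue : ℕ → ℕ → ℕ
  orbitValue v s = (v + s * m) % (m * n)

  ∑-orbitValue-+m : ∀ v → ∑[ s < n ] orbitValue (v + m) s ≡ ∑[ s < n ] orbitValue v s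
  ∑-orbitValue-+m v = +-cancelʳ-≡ (orbitValue v 0) _ _ (begin
    ∑[ s < n ] orbitValue (v + m) s + orbitValue v 0
      ≡⟨ cong (_+ orbitValue v 0) (∑-cong n λ {s} _ → cong (_% (m * n)) (+-assoc v m (s * m))) ⟩
    ∑[ s < n ] orbitValue v (suc s) + orbitValue v 0    ≡⟨ ∑-rotate n (orbitValue v) ⟩
    ∑[ s < n ] orbitValue v s + orbitValue v n          ≡⟨ cong (sumBelow n (orbitValue v) +_) full-turn ⟩
    ∑[ s < n ] orbitValue v s + orbitValue v 0          ∎)
    where
    open ≡-Reasoning
    full-turn : orbitValue v n ≡ orbitValue v 0
    full-turn = begin
      (v + n * m) % (m * n)   ≡⟨ cong (λ k → (v + k) % (m * n)) (*-comm n m) ⟩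
      (v + m * n) % (m * n)   ≡⟨ [m+n]%n≡m%n v (m * n) ⟩
      v % (m * n)             ≡⟨ cong (_% (m * n)) (+-identityʳ v) ⟨
      (v + 0) % (m * n)       ∎

  ∑-orbitValue-%m : ∀ v → ∑[ s < n ] orbitValue v s ≡ ∑[ s < n ] orbitValue (v % m) s
  ∑-orbitValue-%m v =
    trans (cong (λ u → sumBelow n (orbitValue u)) (m≡m%n+[m/n]*n v m)) (drop-multiples (v / m) (v % m))
    where
    drop-multiples : ∀ q r → ∑[ s < n ] orbitValue (r + q * m) s ≡ ∑[ s < n ] orbitValue r s
    drop-multiples zero    r = cong (λ u → sumBelow n (orbitValue u)) (+-identityʳ r)
    drop-multiples (suc q) r = begin
      ∑[ s < n ] orbitValue (r + suc q * m) s   ≡⟨ cong (λ u → sumBelow n (orbitValue u)) (regroup r m q) ⟩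
      ∑[ s < n ] orbitValue (r + q * m + m) s   ≡⟨ ∑-orbitValue-+m (r + q * m) ⟩
      ∑[ s < n ] orbitValue (r + q * m) s       ≡⟨ drop-multiples q r ⟩
      ∑[ s < n ] orbitValue r s                 ∎
      where
      open ≡-Reasoning
      regroup : ∀ r m q → r + suc q * m ≡ r + q * m + m
      regroup = solve-∀

  ∑-orbitValue≤ : ∀ v → ∑[ s < n ] orbitValue v s + n ≤ m * (n C 2) + m * n
  ∑-orbitValue≤ v = begin
    ∑[ s < n ] orbitValue v s + n          ≡⟨ cong (_+ n) (∑-orbitValue-%m v) ⟩
    ∑[ s < n ] orbitValue r s + n          ≡⟨ cong (_+ n) (∑-cong n no-wrap) ⟩
    ∑[ s < n ] (r + s * m) + n             ≡⟨ cong (_+ n) (∑-arithmetic n r m) ⟩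
    n * r + m * (n C 2) + n                ≡⟨ regroup n r (m * (n C 2)) ⟩
    m * (n C 2) + n * suc r                ≤⟨ +-monoʳ-≤ (m * (n C 2)) (*-monoʳ-≤ n (m%n<n v m)) ⟩
    m * (n C 2) + n * m                    ≡⟨ cong (m * (n C 2) +_) (*-comm n m) ⟩
    m * (n C 2) + m * n                    ∎
    where
    open ≤-Reasoning
    r = v % m
    regroup : ∀ n r c → n * r + c + n ≡ c + n * suc r
    regroup = solve-∀
    no-wrap : ∀ {s} → s < n → orbitValue r s ≡ r + s * m
    no-wrap {s} s<n = m<n⇒m%n≡m (begin-strict
      r + s * m        <⟨ +-monoˡ-< (s * m) (m%n<n v m) ⟩
      m + s * m        ≤⟨ *-monoˡ-≤ m s<n ⟩
      n * m            ≡⟨ *-comm n m ⟩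
      m * n            ∎)

  shift^-map : ∀ s {y} → Bounded y → shift^ m n s y ≡ map (λ v → orbitValue v s) y
  shift^-map s {y} by = vec-ext λ i → trans (shift^-lookup s by i) (sym (lookup-map i _ y))

  small-shift : ∀ {x} → Bounded x → ∃ λ s → s < n × sum (shift^ m n s x) + n ≤ m * (n C 2) + m * n
  small-shift {x} bx = pigeonhole n (λ s → sum (shift^ m n s x) + n) _ (begin
    ∑[ s < n ] (sum (shift^ m n s x) + n)
      ≡⟨ ∑-+ n (λ s → sum (shift^ m n s x)) (λ _ → n) ⟩
    ∑[ s < n ] sum (shift^ m n s x) + ∑[ s < n ] n
      ≡⟨ cong₂ _+_ (∑-cong n λ {s} _ → cong sum (shift^-map s bx)) (∑-const n n) ⟩
    ∑[ s < n ] sum (map (λ v → orbitValue v s) x) + n * n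
      ≡⟨ cong (_+ n * n) (∑-sum-map n orbitValue x) ⟩
    sum (map (λ v → ∑[ s < n ] orbitValue v s) x) + n * n
      ≤⟨ sum-map-≤ (λ v → sumBelow n (orbitValue v)) ∑-orbitValue≤ x ⟩
    n * (m * (n C 2) + m * n) ∎)
    where open ≤-Reasoning

module Relaxation (m n : ℕ) .{{_ : NonZero m}} .{{_ : NonZero n}} where
  open Shift m n

  Relaxed : ℕ → Vec ℕ n → Set
  Relaxed D y = ∀ A → 1 ≤ ∣ A ∣ → G m ∣ A ∣ ≤ sumOn A y + ∣ A ∣ + D

  Tight : ℕ → Vec ℕ n → Subset n → Set
  Tight D y S = sumOn S y + ∣ S ∣ + D ≡ G m ∣ S ∣

  Deficit : ℕ → Vec ℕ n → Set
  Deficit e y = sum y + n + m * n * e ≡ G m n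

  IsBreak : Vec ℕ n → Set
  IsBreak y = sum y + n ≡ G m n × Relaxed 0 y

  Break⇒IsBreak : ∀ {y} → Break m n y → IsBreak y
  Break⇒IsBreak {y} (sum≡g , genus≤) =
    ≡genusInduced⇒≡G m n (sum y) sum≡g ,
    λ A ne → subst (G m ∣ A ∣ ≤_) (sym (+-identityʳ _))
                   (genusInduced≤⇒G≤ m ∣ A ∣ (sumOn A y) (genus≤ A ne))

  IsBreak⇒Break : ∀ {y} → IsBreak y → Break m n y
  IsBreak⇒Break {y} (sum+n≡G , relaxed) =
    ≡G⇒≡genusInduced m n (sum y) sum+n≡G ,
    λ A ne → G≤⇒genusInduced≤ m ∣ A ∣ (sumOn A y) (subst (G m ∣ A ∣ ≤_) (+-identityʳ _) (relaxed A ne))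

  Tight-⊤ : ∀ {D y} → sum y + n + D ≡ G m n → Tight D y ⊤
  Tight-⊤ {D} {y} eq = subst₂ (λ s k → s + k + D ≡ G m k) (sym (sumOn-⊤ y)) (sym (∣⊤∣≡n n)) eq

  deficit-relaxed⇒break : ∀ {e y} → Deficit e y → Relaxed 0 y → IsBreak y
  deficit-relaxed⇒break {e} {y} deficit relaxed = ≤-antisym sum+n≤G G≤sum+n , relaxed
    where
    sum+n≤G : sum y + n ≤ G m n
    sum+n≤G = subst (sum y + n ≤_) deficit (m≤m+n (sum y + n) (m * n * e))
    G≤sum+n : G m n ≤ sum y + n
    G≤sum+n = subst₂ (λ k s → G m k ≤ s) (∣⊤∣≡n n)
                (trans (+-identityʳ _) (cong₂ _+_ (sumOn-⊤ y) (∣⊤∣≡n n)))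
                (relaxed ⊤ (subst (1 ≤_) (sym (∣⊤∣≡n n)) (>-nonZero⁻¹ n)))

  vertex-bound : ∀ {D y S i} → Relaxed D y → Tight D y S → i ∈ S → 2 ≤ ∣ S ∣ →
                 lookup y i + m < m * ∣ S ∣
  vertex-bound {D} {y} {S} {i} relaxed tight i∈S 2≤∣S∣ =
    subst (λ k → v + m < m * k) (sym ∣S∣≡1+k′) (begin-strict
      v + m          <⟨ +-monoˡ-< m v<mk′ ⟩
      m * k′ + m     ≡⟨ +-comm (m * k′) m ⟩
      m + m * k′     ≡⟨ *-suc m k′ ⟨
      m * suc k′     ∎)
    where
    open ≤-Reasoning
    v  = lookup y i
    S′ = S ∩ ∁ ⁅ i ⁆
    s′ = sumOn S′ y
    k′ = ∣ S′ ∣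
    ∣S∣≡1+k′ : ∣ S ∣ ≡ suc k′
    ∣S∣≡1+k′ = ∣∣-remove i∈S
    G≤ : G m k′ ≤ s′ + k′ + D
    G≤ = relaxed S′ (≤-pred (subst (2 ≤_) ∣S∣≡1+k′ 2≤∣S∣))
    tight′ : v + s′ + suc k′ + D ≡ G m k′ + m * k′
    tight′ = trans (cong₂ (λ s k → s + k + D) (sym (sumOn-remove y i∈S)) (sym ∣S∣≡1+k′))
                   (trans tight (trans (cong (G m) ∣S∣≡1+k′) (G-suc m k′)))
    regroup : ∀ s k D v → s + k + D + suc v ≡ v + s + suc k + D
    regroup = solve-∀
    v<mk′ : v < m * k′
    v<mk′ = +-cancelˡ-≤ (G m k′) (suc v) (m * k′) (begin
      G m k′ + suc v         ≤⟨ +-monoˡ-≤ (suc v) G≤ ⟩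
      s′ + k′ + D + suc v    ≡⟨ regroup s′ k′ D v ⟩
      v + s′ + suc k′ + D    ≡⟨ tight′ ⟩
      G m k′ + m * k′        ∎)

  relaxed-after-mixed-shift : ∀ {a b k t d s sS sT} →
    G m a ≤ sS + a + suc d → G m b + m * (k * b) ≤ sT + b → b ≤ t →
    s + m * (k + t) * b ≡ sS + sT + t * m * (a + b) → G m (a + b) ≤ s + (a + b) + d
  relaxed-after-mixed-shift {a} {b} {k} {t} {d} {s} {sS} {sT} Ga≤ Gb≤ b≤t split =
    ≤-pred (+-cancelʳ-≤ (m * (k * b)) _ _ (begin
      suc (G m (a + b)) + m * (k * b)
        ≡⟨ cong (_+ m * (k * b)) (trans (+-comm 1 (G m (a + b))) (G-+ m a b)) ⟩
      G m a + G m b + m * (a * b) + m * (k * b)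
        ≡⟨ regroup₁ (G m a) (G m b) (m * (a * b)) (m * (k * b)) ⟩
      G m a + (G m b + m * (k * b)) + m * (a * b)
        ≤⟨ +-mono-≤ (+-mono-≤ Ga≤ Gb≤) (*-monoʳ-≤ m ab≤ta) ⟩
      sS + a + suc d + (sT + b) + m * (t * a)
        ≡⟨ regroup₂ sS a d sT b (m * (t * a)) ⟩
      sS + sT + m * (t * a) + a + b + suc d
        ≡⟨ cong (λ z → z + a + b + suc d) split′ ⟨
      s + m * (k * b) + a + b + suc d
        ≡⟨ regroup₃ s (m * (k * b)) a b d ⟩
      suc (s + (a + b) + d) + m * (k * b) ∎))
    where
    open ≤-Reasoning
    ab≤ta : a * b ≤ t * a
    ab≤ta = subst (_≤ t * a) (*-comm b a) (*-monoˡ-≤ a b≤t)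
    split′ : s + m * (k * b) ≡ sS + sT + m * (t * a)
    split′ = +-cancelʳ-≡ (m * (t * b)) _ _
      (trans (expand₁ s m k t b) (trans split (expand₂ sS sT t m a b)))
      where
      expand₁ : ∀ s m k t b → s + m * (k * b) + m * (t * b) ≡ s + m * (k + t) * b
      expand₁ = solve-∀
      expand₂ : ∀ x y t m a b → x + y + t * m * (a + b) ≡ x + y + m * (t * a) + m * (t * b)
      expand₂ = solve-∀
    regroup₁ : ∀ p q r u → p + q + r + u ≡ p + (q + u) + r
    regroup₁ = solve-∀
    regroup₂ : ∀ x a d y b c → x + a + suc d + (y + b) + c ≡ x + y + c + a + b + suc d
    regroup₂ = solve-∀
    regroup₃ : ∀ s c a b d → s + c + a + b + suc d ≡ suc (s + (a + b) + d) + c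
    regroup₃ = solve-∀

  relaxed-after-inner-shift : ∀ {a b k t d s sS sT} →
    G m a ≤ sS + a + suc d → 1 ≤ t * m * a → b ≡ 0 →
    s + m * (k + t) * b ≡ sS + sT + t * m * (a + b) → G m (a + b) ≤ s + (a + b) + d
  relaxed-after-inner-shift {a} {_} {k} {t} {d} {s} {sS} {sT} Ga≤ 1≤tma refl split = begin
    G m (a + 0)                    ≡⟨ cong (G m) (+-identityʳ a) ⟩
    G m a                          ≤⟨ Ga≤ ⟩
    sS + a + suc d                 ≡⟨ regroup₁ sS a d ⟩
    sS + 1 + a + d                 ≤⟨ +-monoˡ-≤ d (+-monoˡ-≤ a (+-mono-≤ (m≤m+n sS sT) 1≤tma)) ⟩
    sS + sT + t * m * a + a + d    ≡⟨ regroup₂ sS sT t m a d ⟩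
    sS + sT + t * m * (a + 0) + (a + 0) + d  ≡⟨ cong (λ z → z + (a + 0) + d) split ⟨
    s + m * (k + t) * 0 + (a + 0) + d        ≡⟨ regroup₃ s m k t a d ⟩
    s + (a + 0) + d                ∎
    where
    open ≤-Reasoning
    regroup₁ : ∀ x a d → x + a + suc d ≡ x + 1 + a + d
    regroup₁ = solve-∀
    regroup₂ : ∀ x y t m a d → x + y + t * m * a + a + d ≡ x + y + t * m * (a + 0) + (a + 0) + d
    regroup₂ = solve-∀
    regroup₃ : ∀ s m k t a d → s + m * (k + t) * 0 + (a + 0) + d ≡ s + (a + 0) + d
    regroup₃ = solve-∀

  RelaxedShift : ℕ → Vec ℕ n → Set
  RelaxedShift d y = ∃₂ λ t e → Deficit e (shift^ m n t y) × Relaxed d (shift^ m n t y)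

  module Step {d y} (by : Bounded y) (relaxed : Relaxed (suc d) y) where

    Violates : Subset n → Set
    Violates A = 1 ≤ ∣ A ∣ × sumOn A y + ∣ A ∣ + d < G m ∣ A ∣

    violates? : ∀ A → Dec (Violates A)
    violates? A = (1 ≤? ∣ A ∣) ×-dec (sumOn A y + ∣ A ∣ + d <? G m ∣ A ∣)

    relaxed-with-∅ : ∀ A → G m ∣ A ∣ ≤ sumOn A y + ∣ A ∣ + suc d
    relaxed-with-∅ A with ∣ A ∣ | relaxed A
    ... | zero  | _  = subst₂ _≤_ (sym (G-0 m)) (sym (+-suc (sumOn A y + 0) d)) (s≤s z≤n)
    ... | suc _ | ok = ok (s≤s z≤n)

    violator-tight : ∀ S → Violates S → Tight (suc d) y S
    violator-tight S (ne , lt) = ≤-antisym (subst (_≤ G m ∣ S ∣) (sym (+-suc _ d)) lt) (relaxed S ne)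

    violator-size : ∀ S → Violates S → 2 ≤ ∣ S ∣
    violator-size S v with ∣ S ∣ | violator-tight S v | proj₁ v
    ... | suc zero    | tight | _ = contradiction (subst (2 ≤_) (trans tight (G-1 m)) (2≤ (sumOn S y))) λ where (s≤s ())
      where
      2≤ : ∀ s → 2 ≤ s + 1 + suc d
      2≤ s = +-mono-≤ (m≤n+m 1 s) (s≤s z≤n)
    ... | suc (suc _) | _     | _ = s≤s (s≤s z≤n)

    largest-violator : ∀ S → Violates S →
                       ∃ λ L → Violates L × (∀ {A} → ∣ L ∣ < ∣ A ∣ → ¬ Violates A)
    largest-violator S v = search n S v (m≤n+m n ∣ S ∣)
      where
      search : ∀ f S → Violates S → n ≤ ∣ S ∣ + f →
               ∃ λ L → Violates L × (∀ {A} → ∣ L ∣ < ∣ A ∣ → ¬ Violates A)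
      search zero    S v n≤ = S , v , λ {A} ∣S∣<∣A∣ _ →
        <⇒≱ ∣S∣<∣A∣ (≤-trans (∣p∣≤n A) (subst (n ≤_) (+-identityʳ ∣ S ∣) n≤))
      search (suc f) S v n≤ with anySubset? (λ A → violates? A ×-dec (∣ S ∣ <? ∣ A ∣))
      ... | yes (A , vA , ∣S∣<∣A∣) =
        search f A vA (≤-trans n≤ (subst (_≤ ∣ A ∣ + f) (sym (+-suc ∣ S ∣ f)) (+-monoˡ-≤ f ∣S∣<∣A∣)))
      ... | no ∄ = S , v , λ {A} ∣S∣<∣A∣ vA → ∄ (A , vA , ∣S∣<∣A∣)

    module Largest (S : Subset n) (violates : Violates S) (largest : ∀ {A} → ∣ S ∣ < ∣ A ∣ → ¬ Violates A) where

      k = ∣ S ∣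

      tight : Tight (suc d) y S
      tight = violator-tight S violates

      inside-bound : ∀ {i} → i ∈ S → lookup y i + m < m * k
      inside-bound i∈S = vertex-bound relaxed tight i∈S (violator-size S violates)

      -- S ∪ (A ∩ ∁ S) is larger than S, hence not violating, while S itself is tight.
      outside-bound : ∀ A → 1 ≤ ∣ A ∩ ∁ S ∣ →
                      G m ∣ A ∩ ∁ S ∣ + m * (k * ∣ A ∩ ∁ S ∣) ≤ sumOn (A ∩ ∁ S) y + ∣ A ∩ ∁ S ∣
      outside-bound A 1≤b = +-cancelˡ-≤ (G m k) _ _ (begin
        G m k + (G m b + m * (k * b))     ≡⟨ trans (sym (+-assoc (G m k) _ _)) (sym (G-+ m k b)) ⟩
        G m (k + b) + 1                   ≤⟨ +-monoˡ-≤ 1 G≤ ⟩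
        sS + sB + (k + b) + d + 1         ≡⟨ regroup sS sB k b d ⟩
        sS + k + suc d + (sB + b)         ≡⟨ cong (_+ (sB + b)) tight ⟩
        G m k + (sB + b)                  ∎)
        where
        open ≤-Reasoning
        B  = A ∩ ∁ S
        b  = ∣ B ∣
        sS = sumOn S y
        sB = sumOn B y
        ∣S∪B∣ : ∣ S ∪ B ∣ ≡ k + b
        ∣S∪B∣ = ∣∣-∪∩∁ A S
        G≤ : G m (k + b) ≤ sS + sB + (k + b) + d
        G≤ = subst₂ (λ c s → G m c ≤ s + c + d) ∣S∪B∣ (sumOn-∪∩∁ A S y)
               (≮⇒≥ λ short → largest {S ∪ B} (subst (k <_) (sym ∣S∪B∣) (m<m+n k 1≤b))
                                (subst (1 ≤_) (sym ∣S∪B∣) (≤-trans 1≤b (m≤n+m b k)) , short))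
        regroup : ∀ s t k b d → s + t + (k + b) + d + 1 ≡ s + k + suc d + (t + b)
        regroup = solve-∀

      outside-vertex-bound : ∀ {i} → i ∈ ∁ S → m * k ≤ lookup y i
      outside-vertex-bound {i} i∈∁S = +-cancelʳ-≤ 1 (m * k) (lookup y i) (subst₂ _≤_ lhs rhs bound)
        where
        ⁅i⁆∩∁S≡⁅i⁆ : ⁅ i ⁆ ∩ ∁ S ≡ ⁅ i ⁆
        ⁅i⁆∩∁S≡⁅i⁆ = trans (∩-comm ⁅ i ⁆ (∁ S)) (∩-⁅⁆ i∈∁S)
        ∣B∣≡1 : ∣ ⁅ i ⁆ ∩ ∁ S ∣ ≡ 1
        ∣B∣≡1 = trans (cong ∣_∣ ⁅i⁆∩∁S≡⁅i⁆) (∣⁅x⁆∣≡1 i)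
        bound = outside-bound ⁅ i ⁆ (≤-reflexive (sym ∣B∣≡1))
        lhs : G m ∣ ⁅ i ⁆ ∩ ∁ S ∣ + m * (k * ∣ ⁅ i ⁆ ∩ ∁ S ∣) ≡ m * k + 1
        lhs = trans (cong (λ b → G m b + m * (k * b)) ∣B∣≡1)
                    (trans (cong₂ _+_ (G-1 m) (cong (m *_) (*-identityʳ k))) (+-comm 1 (m * k)))
        rhs : sumOn (⁅ i ⁆ ∩ ∁ S) y + ∣ ⁅ i ⁆ ∩ ∁ S ∣ ≡ lookup y i + 1
        rhs = cong₂ _+_ (trans (cong (λ B → sumOn B y) ⁅i⁆∩∁S≡⁅i⁆) (sumOn-⁅⁆ i y)) ∣B∣≡1

      module Whole (k≡n : k ≡ n) where

        y′ = shift m n y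

        S≡⊤ : S ≡ ⊤
        S≡⊤ = ∣p∣≡n⇒p≡⊤ {p = S} k≡n

        deficit≡slack : ∀ {e} → Deficit e y → m * n * e ≡ suc d
        deficit≡slack deficit = +-cancelˡ-≡ (sum y + n) _ _ (trans deficit (sym tight-⊤))
          where
          tight-⊤ : sum y + n + suc d ≡ G m n
          tight-⊤ = subst₂ (λ s c → s + c + suc d ≡ G m c)
                      (trans (cong (λ A → sumOn A y) S≡⊤) (sumOn-⊤ y)) k≡n tight

        carries : Carries 1 y ∅
        carries = carries-intro {1} {y} ∅ by m<mn (λ i∈∅ → contradiction i∈∅ ∉⊥) stays
          where
          stays : ∀ {i} → i ∉ ∅ → lookup y i + 1 * m < m * n
          stays {i} _ = subst₂ (λ a c → lookup y i + a < m * c) (sym (*-identityˡ m)) k≡n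
                          (inside-bound (subst (i ∈_) (sym S≡⊤) ∈⊤))
          m<mn : 1 * m < m * n
          m<mn = subst₂ _<_ (trans (*-identityʳ m) (sym (*-identityˡ m))) refl
                   (*-monoʳ-< m (subst (2 ≤_) k≡n (violator-size S violates)))

        grows : ∀ A → sumOn A y′ ≡ sumOn A y + 1 * m * ∣ A ∣
        grows A = begin
          sumOn A y′                          ≡⟨ +-identityʳ _ ⟨
          sumOn A y′ + 0                      ≡⟨ cong (sumOn A y′ +_) (*-zeroʳ (m * n)) ⟨
          sumOn A y′ + m * n * 0              ≡⟨ cong (λ c → sumOn A y′ + m * n * c) ∣A∩∅∣≡0 ⟨
          sumOn A y′ + m * n * ∣ A ∩ ∅ ∣      ≡⟨ carries-sumOn {1} carries A ⟩
          sumOn A y + 1 * m * ∣ A ∣           ∎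
          where
          open ≡-Reasoning
          ∣A∩∅∣≡0 : ∣ A ∩ ∅ ∣ ≡ 0
          ∣A∩∅∣≡0 = trans (cong ∣_∣ (∩-zeroʳ A)) (∣⊥∣≡0 n)

        deficit-shift : ∀ {e} → Deficit (suc e) y → Deficit e y′
        deficit-shift {e} deficit = begin
          sum y′ + n + m * n * e                     ≡⟨ cong (λ s → s + n + m * n * e) (trans (sym (sumOn-⊤ y′)) (grows ⊤)) ⟩
          sumOn ⊤ y + 1 * m * ∣ ⊤ {n} ∣ + n + m * n * e
            ≡⟨ cong₂ (λ s c → s + 1 * m * c + n + m * n * e) (sumOn-⊤ y) (∣⊤∣≡n n) ⟩
          sum y + 1 * m * n + n + m * n * e          ≡⟨ regroup (sum y) m n e ⟩
          sum y + n + m * n * suc e                  ≡⟨ deficit ⟩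
          G m n                                      ∎
          where
          open ≡-Reasoning
          regroup : ∀ s m n e → s + 1 * m * n + n + m * n * e ≡ s + n + m * n * suc e
          regroup = solve-∀

        relaxed-shift : Relaxed d y′
        relaxed-shift A 1≤∣A∣ = begin
          G m ∣ A ∣                             ≤⟨ relaxed A 1≤∣A∣ ⟩
          sumOn A y + ∣ A ∣ + suc d             ≡⟨ regroup (sumOn A y) ∣ A ∣ d ⟩
          sumOn A y + 1 + ∣ A ∣ + d             ≤⟨ +-monoˡ-≤ d (+-monoˡ-≤ ∣ A ∣ (+-monoʳ-≤ (sumOn A y) 1≤m∣A∣)) ⟩
          sumOn A y + 1 * m * ∣ A ∣ + ∣ A ∣ + d ≡⟨ cong (λ s → s + ∣ A ∣ + d) (grows A) ⟨
          sumOn A y′ + ∣ A ∣ + d                ∎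
          where
          open ≤-Reasoning
          regroup : ∀ s a d → s + a + suc d ≡ s + 1 + a + d
          regroup = solve-∀
          1≤m∣A∣ : 1 ≤ 1 * m * ∣ A ∣
          1≤m∣A∣ = *-mono-≤ (subst (1 ≤_) (sym (*-identityˡ m)) (>-nonZero⁻¹ m)) 1≤∣A∣

        shift-once : ∀ {e} → Deficit e y → RelaxedShift d y
        shift-once {zero}  deficit =
          contradiction (deficit≡slack deficit) λ mn*0≡1+d → 0≢1+n (trans (sym (*-zeroʳ (m * n))) mn*0≡1+d)
        shift-once {suc e} deficit = 1 , e , deficit-shift deficit , relaxed-shift

      module Complement (k≢n : k ≢ n) where

        T  = ∁ S
        t  = ∣ T ∣
        y′ = shift^ m n t y

        n≡k+t : n ≡ k + t
        n≡k+t = trans (sym (∣⊤∣≡n n))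
                  (trans (∣∣-∩∁ ⊤ S) (cong₂ (λ A B → ∣ A ∣ + ∣ B ∣) (∩-identityˡ S) (∩-identityˡ T)))

        1≤t : 1 ≤ t
        1≤t = n≢0⇒n>0 λ t≡0 → k≢n (sym (trans n≡k+t (trans (cong (k +_) t≡0) (+-identityʳ k))))

        mn≡mk+tm : m * n ≡ m * k + t * m
        mn≡mk+tm = trans (cong (m *_) n≡k+t) (trans (*-distribˡ-+ m k t) (cong (m * k +_) (*-comm m t)))

        carries : Carries t y T
        carries = carries-intro {t} {y} T by tm<mn wraps stays
          where
          tm<mn : t * m < m * n
          tm<mn = subst₂ _<_ refl (trans (*-comm _ m) (cong (m *_) (sym n≡k+t)))
                    (*-monoˡ-< m (m<n+m t (≤-trans (s≤s z≤n) (violator-size S violates))))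
          wraps : ∀ {i} → i ∈ T → m * n ≤ lookup y i + t * m
          wraps {i} i∈T = subst (_≤ lookup y i + t * m) (sym mn≡mk+tm)
                            (+-monoˡ-≤ (t * m) (outside-vertex-bound i∈T))
          stays : ∀ {i} → i ∉ T → lookup y i + t * m < m * n
          stays {i} i∉T = subst (lookup y i + t * m <_) (sym mn≡mk+tm)
            (+-monoˡ-< (t * m) (≤-trans (s≤s (m≤m+n (lookup y i) m)) (inside-bound (x∉∁p⇒x∈p i∉T))))

        sum-kept : sum y′ ≡ sum y
        sum-kept = +-cancelʳ-≡ (m * n * t) _ _
          (trans (carries-sum {t} {y} {T} carries) (cong (sum y +_) (tmn≡mnt t m n)))
          where
          tmn≡mnt : ∀ t m n → t * m * n ≡ m * n * t
          tmn≡mnt = solve-∀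

        split : ∀ A → sumOn A y′ + m * (k + t) * ∣ A ∩ T ∣ ≡
                      sumOn (A ∩ S) y + sumOn (A ∩ T) y + t * m * (∣ A ∩ S ∣ + ∣ A ∩ T ∣)
        split A = begin
          sumOn A y′ + m * (k + t) * ∣ A ∩ T ∣   ≡⟨ cong (λ c → sumOn A y′ + m * c * ∣ A ∩ T ∣) n≡k+t ⟨
          sumOn A y′ + m * n * ∣ A ∩ T ∣         ≡⟨ carries-sumOn {t} carries A ⟩
          sumOn A y + t * m * ∣ A ∣               ≡⟨ cong₂ (λ s c → s + t * m * c) (sumOn-∩∁ A S y) (∣∣-∩∁ A S) ⟩
          sumOn (A ∩ S) y + sumOn (A ∩ T) y + t * m * (∣ A ∩ S ∣ + ∣ A ∩ T ∣) ∎
          where open ≡-Reasoning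

        relaxed-shift : Relaxed d y′
        relaxed-shift A 1≤∣A∣ =
          subst (λ c → G m c ≤ sumOn A y′ + c + d) (sym (∣∣-∩∁ A S)) (by-cases (1 ≤? ∣ A ∩ T ∣))
          where
          by-cases : Dec (1 ≤ ∣ A ∩ T ∣) →
                     G m (∣ A ∩ S ∣ + ∣ A ∩ T ∣) ≤ sumOn A y′ + (∣ A ∩ S ∣ + ∣ A ∩ T ∣) + d
          by-cases (yes 1≤b) = relaxed-after-mixed-shift (relaxed-with-∅ (A ∩ S)) (outside-bound A 1≤b)
                                                         (∣p∩q∣≤∣q∣ A T) (split A)
          by-cases (no  1≰b) = relaxed-after-inner-shift {k = k} {t = t} (relaxed-with-∅ (A ∩ S)) 1≤tma b≡0 (split A)
            where
            b≡0 : ∣ A ∩ T ∣ ≡ 0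
            b≡0 = n≤0⇒n≡0 (≤-pred (≰⇒> 1≰b))
            1≤a : 1 ≤ ∣ A ∩ S ∣
            1≤a = subst (1 ≤_) (trans (∣∣-∩∁ A S) (trans (cong (∣ A ∩ S ∣ +_) b≡0) (+-identityʳ _))) 1≤∣A∣
            1≤tma : 1 ≤ t * m * ∣ A ∩ S ∣
            1≤tma = *-mono-≤ (*-mono-≤ 1≤t (>-nonZero⁻¹ m)) 1≤a

        shift-complement : ∀ {e} → Deficit e y → RelaxedShift d y
        shift-complement {e} deficit =
          t , e , subst (λ s → s + n + m * n * e ≡ G m n) (sym sum-kept) deficit , relaxed-shift

    relax : ∀ {e} → Deficit e y → RelaxedShift d y
    relax {e} deficit with anySubset? violates?
    ... | no ∄ = 0 , e , deficit , λ A 1≤∣A∣ → ≮⇒≥ λ short → ∄ (A , 1≤∣A∣ , short)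
    ... | yes (S , violates) with largest-violator S violates
    ... | L , violatesL , largest with ∣ L ∣ ≟ n
    ... | yes ∣L∣≡n = Largest.Whole.shift-once L violatesL (λ {A} → largest {A}) ∣L∣≡n deficit
    ... | no  ∣L∣≢n = Largest.Complement.shift-complement L violatesL (λ {A} → largest {A}) ∣L∣≢n deficit

  Relaxed-G : ∀ y → Relaxed (G m n) y
  Relaxed-G y A _ = ≤-trans (G-mono m (∣p∣≤n A)) (m≤n+m (G m n) (sumOn A y + ∣ A ∣))

  break-in-orbit : ∀ d {e y} → Bounded y → Deficit e y → Relaxed d y → ∃ λ t → IsBreak (shift^ m n t y)
  break-in-orbit zero            by deficit relaxed = 0 , deficit-relaxed⇒break deficit relaxed
  break-in-orbit (suc d) {y = y} by deficit relaxed with Step.relax by relaxed deficit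
  ... | t , e′ , deficit′ , relaxed′ with break-in-orbit d (shift^-bounded t by) deficit′ relaxed′
  ... | t′ , isBreak = t′ + t , subst IsBreak (sym (shift^-+ t′ t y)) isBreak

module Uniqueness (m n : ℕ) .{{_ : NonZero m}} .{{_ : NonZero n}} where
  open Shift m n
  open Relaxation m n

  break-bounded : ∀ {y} → IsBreak y → Bounded y
  break-bounded {y} (sum+n≡G , relaxed) i with 2 ≤? n
  ... | yes 2≤n = ≤-<-trans (m≤m+n (lookup y i) m) (subst (λ c → lookup y i + m < m * c) (∣⊤∣≡n n)
                    (vertex-bound relaxed (Tight-⊤ (trans (+-identityʳ _) sum+n≡G)) ∈⊤
                                  (subst (2 ≤_) (sym (∣⊤∣≡n n)) 2≤n)))
  ... | no  2≰n = ≤-<-trans yᵢ≤0 (>-nonZero⁻¹ (m * n))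
    where
    n≡1 : n ≡ 1
    n≡1 = ≤-antisym (≤-pred (≰⇒> 2≰n)) (>-nonZero⁻¹ n)
    sum≡0 : sum y ≡ 0
    sum≡0 = +-cancelʳ-≡ 1 (sum y) 0 (trans (subst (λ c → sum y + c ≡ G m c) n≡1 sum+n≡G) (G-1 m))
    yᵢ≤0 : lookup y i ≤ 0
    yᵢ≤0 = subst (lookup y i ≤_) (trans (sym (sumOn-remove y ∈⊤)) (trans (sumOn-⊤ y) sum≡0))
             (m≤m+n (lookup y i) _)

  no-break-split : ∀ {t u X Y Z} → Z + m * (t + u) * t ≡ X + t * m * t →
                   G m t ≤ Z + t → G m u ≤ Y + u → X + Y + (t + u) ≡ G m (t + u) → ⊥
  no-break-split {t} {u} {X} {Y} {Z} carried Gt≤ Gu≤ total = 1+n≰n (begin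
    suc (G m (t + u))               ≡⟨ trans (+-comm 1 (G m (t + u))) (G-+ m t u) ⟩
    G m t + G m u + m * (t * u)     ≤⟨ +-monoˡ-≤ (m * (t * u)) (+-mono-≤ Gt≤ Gu≤) ⟩
    Z + t + (Y + u) + m * (t * u)   ≡⟨ regroup Z t Y u (m * (t * u)) ⟩
    Z + m * (t * u) + Y + (t + u)   ≡⟨ cong (λ z → z + Y + (t + u)) Z+mtu≡X ⟩
    X + Y + (t + u)                 ≡⟨ total ⟩
    G m (t + u)                     ∎)
    where
    open ≤-Reasoning
    regroup : ∀ z t y u c → z + t + (y + u) + c ≡ z + c + y + (t + u)
    regroup = solve-∀
    Z+mtu≡X : Z + m * (t * u) ≡ X
    Z+mtu≡X = +-cancelʳ-≡ (t * m * t) _ _ (trans (expand Z m t u) carried)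
      where
      expand : ∀ z m t u → z + m * (t * u) + t * m * t ≡ z + m * (t + u) * t
      expand = solve-∀

  module ProperShift {t a} (ba : Bounded a) (isBreak : IsBreak a) (isBreak′ : IsBreak (shift^ m n t a))
                     (1≤t : 1 ≤ t) (t<n : t < n) where

    a′ = shift^ m n t a
    W  = carrySet t a
    u  = ∣ ∁ W ∣

    carries : Carries t a W
    carries = carries-carrySet t ba (subst (t * m <_) (*-comm n m) (*-monoˡ-< m t<n))

    ∣W∣≡t : ∣ W ∣ ≡ t
    ∣W∣≡t = *-cancelˡ-≡ ∣ W ∣ t (m * n) (+-cancelˡ-≡ (sum a) _ _ (begin
      sum a + m * n * ∣ W ∣   ≡⟨ cong (_+ m * n * ∣ W ∣) (+-cancelʳ-≡ n _ _ (trans (proj₁ isBreak) (sym (proj₁ isBreak′)))) ⟩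
      sum a′ + m * n * ∣ W ∣  ≡⟨ carries-sum {t} {a} {W} carries ⟩
      sum a + t * m * n       ≡⟨ cong (sum a +_) (tmn≡mnt t m n) ⟩
      sum a + m * n * t       ∎))
      where
      open ≡-Reasoning
      tmn≡mnt : ∀ t m n → t * m * n ≡ m * n * t
      tmn≡mnt = solve-∀

    n≡t+u : n ≡ t + u
    n≡t+u = trans (sym (∣⊤∣≡n n)) (trans (∣∣-∩∁ ⊤ W)
              (cong₂ _+_ (trans (cong ∣_∣ (∩-identityˡ W)) ∣W∣≡t) (cong ∣_∣ (∩-identityˡ (∁ W)))))

    1≤u : 1 ≤ u
    1≤u = n≢0⇒n>0 λ u≡0 → <-irrefl (sym (trans n≡t+u (trans (cong (t +_) u≡0) (+-identityʳ t)))) t<n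

    absurd : ⊥
    absurd = no-break-split carried Gt≤ Gu≤ total
      where
      carried : sumOn W a′ + m * (t + u) * t ≡ sumOn W a + t * m * t
      carried = subst₂ (λ c w → sumOn W a′ + m * c * w ≡ sumOn W a + t * m * w) n≡t+u ∣W∣≡t
                  (subst (λ B → sumOn W a′ + m * n * ∣ B ∣ ≡ sumOn W a + t * m * ∣ W ∣) (∩-idem W)
                    (carries-sumOn {t} carries W))
      Gt≤ : G m t ≤ sumOn W a′ + t
      Gt≤ = subst (λ c → G m c ≤ sumOn W a′ + c) ∣W∣≡t
              (subst (G m ∣ W ∣ ≤_) (+-identityʳ _) (proj₂ isBreak′ W (subst (1 ≤_) (sym ∣W∣≡t) 1≤t)))
      Gu≤ : G m u ≤ sumOn (∁ W) a + u
      Gu≤ = subst (G m u ≤_) (+-identityʳ _) (proj₂ isBreak (∁ W) 1≤u)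
      total : sumOn W a + sumOn (∁ W) a + (t + u) ≡ G m (t + u)
      total = trans (cong₂ _+_ (sym sum≡) (sym n≡t+u)) (trans (proj₁ isBreak) (cong (G m) n≡t+u))
        where
        sum≡ : sum a ≡ sumOn W a + sumOn (∁ W) a
        sum≡ = trans (sym (sumOn-⊤ a)) (trans (sumOn-∩∁ ⊤ W a)
                 (cong₂ (λ A B → sumOn A a + sumOn B a) (∩-identityˡ W) (∩-identityˡ (∁ W))))

  break-shift-unique : ∀ t {a} → Bounded a → IsBreak a → IsBreak (shift^ m n t a) → shift^ m n t a ≡ a
  break-shift-unique t {a} ba isBreak isBreak′ =
    trans (shift^-%n t ba) (reduced (t % n) (m%n<n t n) (subst IsBreak (shift^-%n t ba) isBreak′))
    where
    reduced : ∀ r → r < n → IsBreak (shift^ m n r a) → shift^ m n r a ≡ a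
    reduced zero    _   _        = refl
    reduced (suc r) r<n isBreak′ = ⊥-elim (ProperShift.absurd ba isBreak isBreak′ (s≤s z≤n) r<n)

module Orbit (m n : ℕ) .{{_ : NonZero m}} .{{_ : NonZero n}} where
  open Shift m n
  open Averaging m n
  open Relaxation m n
  open Uniqueness m n

  congruent : ∀ {s} → ℤ.+ (m * n) ∣ ℤ.+ s ℤ.- gmn m n →
              ∃₂ λ p q → s + n + m * n * p ≡ G m n + m * n * q
  congruent {s} = ∣⊖⇒≡-mod ∘ subst (ℤ.+ (m * n) ∣_) (begin
    ℤ.+ s ℤ.- genusInduced m n                    ≡⟨ cong (λ g → ℤ.+ s ℤ.- g) (genusInduced≡G-size m n) ⟩
    ℤ.+ s ℤ.- (ℤ.+ G m n ℤ.- ℤ.+ n)               ≡⟨ regroup (ℤ.+ s) (ℤ.+ n) (ℤ.+ G m n) ⟩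
    ℤ.+ (s + n) ℤ.- ℤ.+ G m n                     ≡⟨ ℤ.m-n≡m⊖n (s + n) (G m n) ⟩
    (s + n) ⊖ G m n                               ∎)
    where
    open ≡-Reasoning
    regroup : ∀ (s n g : ℤ) → s ℤ.- (g ℤ.- n) ≡ s ℤ.+ n ℤ.- g
    regroup = ℤ-Solver.solve-∀

  initial-deficit : ∀ {x} → InD m n x → ∃₂ λ s e → Deficit e (shift^ m n s x)
  initial-deficit {x} (bx , N∣sum-g) with congruent N∣sum-g | small-shift bx
  ... | p , q , sum≡ | s , s<n , small = s , ≡-mod-below same-class below
    where
    y = shift^ m n s x
    W = carrySet s x
    carried : sum y + m * n * ∣ W ∣ ≡ sum x + s * m * n
    carried = carries-sum {s} {x} {W} (carries-carrySet s bx (subst (s * m <_) (*-comm n m) (*-monoˡ-< m s<n)))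
    same-class : sum y + n + m * n * (∣ W ∣ + p) ≡ G m n + m * n * (q + s)
    same-class = begin
      sum y + n + m * n * (∣ W ∣ + p)       ≡⟨ regroup₁ (sum y) n (m * n) ∣ W ∣ p ⟩
      sum y + m * n * ∣ W ∣ + n + m * n * p ≡⟨ cong (λ z → z + n + m * n * p) carried ⟩
      sum x + s * m * n + n + m * n * p     ≡⟨ regroup₂ (sum x) s m n p ⟩
      sum x + n + m * n * p + s * m * n     ≡⟨ cong (_+ s * m * n) sum≡ ⟩
      G m n + m * n * q + s * m * n         ≡⟨ regroup₃ (G m n) m n q s ⟩
      G m n + m * n * (q + s)               ∎
      where
      open ≡-Reasoning
      regroup₁ : ∀ y n N w p → y + n + N * (w + p) ≡ y + N * w + n + N * p
      regroup₁ = solve-∀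
      regroup₂ : ∀ x s m n p → x + s * m * n + n + m * n * p ≡ x + n + m * n * p + s * m * n
      regroup₂ = solve-∀
      regroup₃ : ∀ g m n q s → g + m * n * q + s * m * n ≡ g + m * n * (q + s)
      regroup₃ = solve-∀
    below : sum y + n < G m n + m * n
    below = subst (suc (sum y + n) ≤_)
              (trans (sym (+-suc (m * (n C 2)) (m * n))) (sym (+-assoc (m * (n C 2)) 1 (m * n)))) (s≤s small)

  break-exists : ∀ {x} → InD m n x → ∃ λ s → IsBreak (shift^ m n s x)
  break-exists {x} inD@(bx , _) =
    let s , e , deficit = initial-deficit inD
        t , isBreak     = break-in-orbit (G m n) (shift^-bounded s bx) deficit (Relaxed-G _)
    in  t + s , subst IsBreak (sym (shift^-+ t s x)) isBreak

  ShiftEquiv⇒shift^ : ∀ {x b} → Bounded b → ShiftEquiv m n x b → ∃ λ j → shift^ m n j x ≡ b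
  ShiftEquiv⇒shift^         bb (j , inj₁ xj≡b) = j , xj≡b
  ShiftEquiv⇒shift^         bb (j , inj₂ bj≡x) =
    j * (n ∸ 1) , trans (cong (shift^ m n (j * (n ∸ 1))) (sym bj≡x)) (shift^-inverse j bb)

  break-unique : ∀ {x s b} → Bounded x → IsBreak (shift^ m n s x) →
                 ShiftEquiv m n x b → IsBreak b → b ≡ shift^ m n s x
  break-unique {x} {s} {b} bx isBreak x~b isBreak-b
    with ShiftEquiv⇒shift^ (break-bounded isBreak-b) x~b
  ... | j , xj≡b = trans b≡ (break-shift-unique t (shift^-bounded s bx) isBreak (subst IsBreak b≡ isBreak-b))
    where
    a = shift^ m n s x
    t = j + s * (n ∸ 1)
    b≡ : b ≡ shift^ m n t a
    b≡ = begin
      b                                        ≡⟨ xj≡b ⟨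
      shift^ m n j x                           ≡⟨ cong (shift^ m n j) (shift^-inverse s bx) ⟨
      shift^ m n j (shift^ m n (s * (n ∸ 1)) a) ≡⟨ shift^-+ j (s * (n ∸ 1)) a ⟨
      shift^ m n t a                           ∎
      where open ≡-Reasoning

proposition3p6 : (m n : ℕ) .{{_ : NonZero m}} .{{_ : NonZero n}} →
    (x : Vec ℕ n) → InD m n x →
    ∃ λ a → ShiftEquiv m n x a × Break m n a ×
      (∀ b → ShiftEquiv m n x b → Break m n b → b ≡ a)
proposition3p6 m n x inD@(bx , _) =
  let s , isBreak = Orbit.break-exists m n inD in
  shift^ m n s x , (s , inj₁ refl) , Relaxation.IsBreak⇒Break m n isBreak ,
  λ b x~b b-break → Orbit.break-unique m n {s = s} bx isBreak x~b (Relaxation.Break⇒IsBreak m n b-break)
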